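{- Let $H$ be a type B or type C Hessenberg space and $i\in[n-1]$ such that either $i\in[n-2]$ and $t_i\notin S(H)$, or $i=n-1$ and $\{t_{n-1},t_n\}\cap S(H)=\emptyset$. Then $\mathbf{y}_{i,k}\in\mathcal{M}_H$ for every $k\in[\bar n]$.
   Context: Let $n\ge 2$, $[n]=\{1,\dots,n\}$, $[\bar n]=\{\pm1,\dots,\pm n\}$, $\bar i=-i$. $\mathfrak{W}_n$ is the group of bijections $w$ of $[\bar n]$ with $w(\bar i)=\overline{w(i)}$. For $p,q\in[\bar n]$, $q\ne\pm p$, $(p,q)$ exchanges $p\leftrightarrow q$, $\bar p\leftrightarrow\bar q$; $(p,\bar p)$ exchanges $p,\bar p$. Roots: type B $\Phi^+=\{e_i\pm e_j:i<j\}\cup\{e_i\}$, $\alpha_i=e_i-e_{i+1}$, $\alpha_n=e_n$; type C $\Phi^+=\{e_i\pm e_j\}\cup\{2e_i\}$, $\alpha_n=2e_n$; $\Delta=\{\alpha_i\}$; $\alpha\le\beta$ iff $\beta-\alpha$ is a nonnegative integer combination of simple roots. A Hessenberg space is a lower order ideal $H\supseteq\Delta$ of $\Phi^+$. Reflections: $e_i-e_j\mapsto(i,j)$, $e_i+e_j\mapsto(i,\bar j)$, $e_i$ or $2e_i\mapsto(i,\bar i)$; $S(H)$ = reflections of roots in $H$. Transpositions: $t_i=(i,i+2)$ ($i\in[n-2]$), $t_{n-1}=(n-1,\overline{n-1})$, $t_n=(n-1,\bar n)$. With $x_{\bar k}:=-x_k$, $\mathcal{M}_H$ is the set of $\rho:\mathfrak{W}_n\to\mathbb{C}[x_1,\dots,x_n]$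 with $\rho(w)-\rho(ws)\in\langle x_{w(p)}-x_{w(q)}\rangle$ for all $w$ and all $s\in S(H)$ exchanging $p$ and $q$ ($q\ne p$, possibly $q=\bar p$). For $k\in[\bar n]$, $\mathbf{y}_{i,k}(w)=x_k-x_{w(i+1)}$ if $w^{ -1}(k)\in[i]$ and $0$ otherwise. -}

module Defs where

open import Data.Bool using (Bool; true; false; not; if_then_else_)
import Data.Bool.Properties as BoolP
open import Data.Nat as ℕ using (ℕ; zero; suc)
import Data.Nat.Properties as ℕP
open import Data.Fin as Fin using (Fin; toℕ)
import Data.Fin.Properties as FinP
open import Data.Integer as ℤ using (ℤ; +_)
open import Data.Rational as ℚ using (ℚ)
open import Data.Product using (Σ; ∃; _×_; _,_)
import Data.Product.Properties as ProdP
open import Data.Empty using (⊥)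
open import Relation.Nullary using (¬_; Dec; yes; no)
open import Relation.Nullary.Decidable using (⌊_⌋; _×-dec_)
open import Relation.Binary.PropositionalEquality using (_≡_; _≢_)
open import Relation.Binary.Definitions using (DecidableEquality)
open import Function using (_∘_)

-- Signed index set [n̄] = {±1,…,±n}.  (true , j) stands for +(j+1),
-- (false , j) for −(j+1)  (Fin n is 0-based).

SI : ℕ → Set
SI n = Bool × Fin n

bar : ∀ {n} → SI n → SI n
bar (s , j) = (not s , j)

_≟SI_ : ∀ {n} → DecidableEquality (SI n)
_≟SI_ = ProdP.≡-dec BoolP._≟_ FinP._≟_

pos : ∀ {n} → Fin n → SI n
pos j = (true , j)

neg : ∀ {n} → Fin n → SI n
neg j = (false , j)

record SignedPerm (n : ℕ) : Set where
  field
    fun  : SI n → SI n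
    inv  : SI n → SI n
    linv : ∀ a → inv (fun a) ≡ a
    rinv : ∀ a → fun (inv a) ≡ a
    odd  : ∀ a → fun (bar a) ≡ bar (fun a)
open SignedPerm public

-- The signed transposition (p,q): exchanges p ↔ q and p̄ ↔ q̄
-- (for q = p̄ it just exchanges p and p̄).
swapFun : ∀ {n} → SI n → SI n → SI n → SI n
swapFun p q a =
  if ⌊ a ≟SI p ⌋ then q else
  if ⌊ a ≟SI q ⌋ then p else
  if ⌊ a ≟SI bar p ⌋ then bar q else
  if ⌊ a ≟SI bar q ⌋ then bar p else a

-- Polynomials ℚ[x₁,…,xₙ] (syntax, with equality = equality as
-- polynomial functions on ℚⁿ, which is polynomial equality since ℚ is
-- infinite).

data Poly (n : ℕ) : Set where
  var  : Fin n → Poly n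
  con  : ℚ → Poly n
  _⊕_  : Poly n → Poly n → Poly n
  _⊗_  : Poly n → Poly n → Poly n
  ⊝_   : Poly n → Poly n

eval : ∀ {n} → (Fin n → ℚ) → Poly n → ℚ
eval v (var j) = v j
eval v (con c) = c
eval v (f ⊕ g) = eval v f ℚ.+ eval v g
eval v (f ⊗ g) = eval v f ℚ.* eval v g
eval v (⊝ f)   = ℚ.- eval v f

_⊖_ : ∀ {n} → Poly n → Poly n → Poly n
f ⊖ g = f ⊕ (⊝ g)

_∈⟨_⟩ : ∀ {n} → Poly n → Poly n → Set
f ∈⟨ g ⟩ = Σ (Poly _) λ h → ∀ v → eval v f ≡ eval v h ℚ.* eval v g

xs : ∀ {n} → SI n → Poly n
xs (true  , j) = var j
xs (false , j) = ⊝ var j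

data Typ : Set where
  B C : Typ

-- positive roots: e_i − e_j, e_i + e_j (i<j), and e_i (type B) / 2e_i (type C)
data PosRoot (n : ℕ) : Set where
  minus : (i j : Fin n) → i Fin.< j → PosRoot n
  plus  : (i j : Fin n) → i Fin.< j → PosRoot n
  long  : (i : Fin n) → PosRoot n

longCoef : Typ → ℤ
longCoef B = + 1
longCoef C = + 2

ind : ∀ {n} → Fin n → Fin n → ℤ
ind k i = if ⌊ k FinP.≟ i ⌋ then + 1 else + 0

rootVec : ∀ {n} → Typ → PosRoot n → Fin n → ℤ
rootVec T (minus i j _) k = ind k i ℤ.- ind k j
rootVec T (plus i j _)  k = ind k i ℤ.+ ind k j
rootVec T (long i)      k = longCoef T ℤ.* ind k i

-- coordinates of the simple root α_{i+1} (0-based i):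
-- e_i − e_{i+1} if i+1 < n, and e_n / 2e_n for the last one
simpleVec : ∀ {n} → Typ → Fin n → Fin n → ℤ
simpleVec {n} T i k =
  if ⌊ suc (toℕ i) ℕ.≟ n ⌋ then longCoef T ℤ.* ind k i
  else ind k i ℤ.- (if ⌊ suc (toℕ i) ℕ.≟ toℕ k ⌋ then + 1 else + 0)

IsSimple : ∀ {n} → PosRoot n → Set
IsSimple (minus i j _) = suc (toℕ i) ≡ toℕ j
IsSimple (plus i j _)  = ⊥
IsSimple {n} (long i)  = suc (toℕ i) ≡ n

∑ : ∀ {n} → (Fin n → ℤ) → ℤ
∑ {zero}  f = + 0
∑ {suc n} f = f Fin.zero ℤ.+ ∑ (f ∘ Fin.suc)

_≤[_]_ : ∀ {n} → PosRoot n → Typ → PosRoot n → Set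
_≤[_]_ {n} α T β = Σ (Fin n → ℕ) λ c →
  ∀ k → rootVec T β k ≡ rootVec T α k ℤ.+ ∑ (λ j → (+ c j) ℤ.* simpleVec T j k)

IsHessenberg : ∀ {n} → Typ → (PosRoot n → Set) → Set
IsHessenberg {n} T H =
  (∀ α → IsSimple α → H α) × (∀ α β → α ≤[ T ] β → H β → H α)

reflPair : ∀ {n} → PosRoot n → SI n × SI n
reflPair (minus i j _) = (pos i , pos j)
reflPair (plus i j _)  = (pos i , neg j)
reflPair (long i)      = (pos i , neg i)

reflOf : ∀ {n} → PosRoot n → SI n → SI n
reflOf α with reflPair α
... | (p , q) = swapFun p q

InS : ∀ {n} → (PosRoot n → Set) → (SI n → SI n) → Set
InS H f = ∃ λ α → H α × (∀ a → reflOf α a ≡ f a)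

-- ρ ∈ 𝓜_H.  (ws is any element of 𝔚ₙ equal pointwise to w ∘ s.)
InM : ∀ {n} → (PosRoot n → Set) → (SignedPerm n → Poly n) → Set
InM {n} H ρ =
  ∀ α → H α → ∀ (p q : SI n) → q ≢ p → reflOf α p ≡ q → reflOf α q ≡ p →
  ∀ (w ws : SignedPerm n) → (∀ a → fun ws a ≡ fun w (reflOf α a)) →
  (ρ w ⊖ ρ ws) ∈⟨ xs (fun w p) ⊖ xs (fun w q) ⟩

-- Specialisation n = m + 2.  Indices i ∈ [n−1] are given 0-based as
-- i₀ : Fin (suc m)  (i = toℕ i₀ + 1).

-- t_i = (i, i+2) for i ∈ [n−2], given 0-based as j : Fin m
tMid : ∀ {m} → Fin m → SI (suc (suc m)) → SI (suc (suc m))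
tMid j = swapFun (pos (Fin.inject₁ (Fin.inject₁ j))) (pos (Fin.suc (Fin.suc j)))

-- t_{n−1} = (n−1, \overline{n−1})
tPen : ∀ {m} → SI (suc (suc m)) → SI (suc (suc m))
tPen {m} = swapFun (pos (Fin.inject₁ (Fin.fromℕ m))) (neg (Fin.inject₁ (Fin.fromℕ m)))

-- t_n = (n−1, n̄)
tLast : ∀ {m} → SI (suc (suc m)) → SI (suc (suc m))
tLast {m} = swapFun (pos (Fin.inject₁ (Fin.fromℕ m))) (neg (Fin.fromℕ (suc m)))

yPoly : ∀ {m} → Fin (suc m) → SI (suc (suc m)) → SignedPerm (suc (suc m)) → Poly (suc (suc m))
yPoly i₀ k w =
  if ⌊ FinP.any? (λ j → (toℕ j ℕ.≤? toℕ i₀) ×-dec (fun w (pos j) ≟SI k)) ⌋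
  then xs k ⊖ xs (fun w (pos (Fin.suc i₀)))
  else con ℚ.0ℚ

-- Let s ∈ S(H) and ws = w ∘ s. A root of H whose reflection sent some element of [i] outside
-- [i + 1] would dominate the root of tᵢ (resp. of t_{n−1} or t_n); since H is a lower order
-- ideal, the hypothesis rules this out, so s maps [i] into [i + 1]. Hence if only one of w, ws
-- sends an element j of [i] to k, then s swaps j and i + 1 and 𝐲(w) − 𝐲(ws) = x_{w(j)} − x_{w(s j)};
-- if both do, 𝐲(w) − 𝐲(ws) = −(x_{w(i+1)} − x_{w(s(i+1))}). Finally, as s is a signed
-- transposition, each x_{w(a)} − x_{w(s a)} is 0 or ±(x_{w(p)} − x_{w(q)}).
module Submission where

open import Defs
open import Data.Nat using (ℕ; suc)
open import Data.Fin as Fin using (Fin)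
open import Data.Product using (∃; _×_)
open import Data.Sum using (_⊎_)
open import Relation.Nullary using (¬_)
open import Relation.Binary.PropositionalEquality using (_≡_)

open import Data.Bool using (true; false; if_then_else_)
import Data.Bool.Properties as BoolP
open import Data.Nat as ℕ using (zero; _≤_; _<_; _≤′_; ≤′-refl; ≤′-step)
import Data.Nat.Properties as ℕP
open import Data.Fin using (toℕ)
import Data.Fin.Properties as FinP
open import Data.Integer as ℤ using (ℤ; +_)
import Data.Integer.Properties as ℤP
open import Data.Integer.Tactic.RingSolver using (solve-∀)
open import Algebra.Properties.CommutativeSemigroup ℤP.+-commutativeSemigroup using (interchange)
open import Data.Rational as ℚ using (ℚ; 0ℚ; 1ℚ)
import Data.Rational.Properties as ℚP
open import Data.Rational.Solver using (module +-*-Solver)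
open import Data.Product using (_,_; proj₁; proj₂)
open import Data.Sum using (inj₁; inj₂)
open import Function using (_∘_)
open import Relation.Nullary using (Dec; yes; no; contradiction)
open import Relation.Nullary.Decidable using (⌊_⌋; _×-dec_)
open import Relation.Binary.PropositionalEquality
  using (_≢_; _≗_; refl; sym; trans; cong; cong₂; subst; subst₂; module ≡-Reasoning)
open +-*-Solver

if-yes : ∀ {A P : Set} (d : Dec P) {x y : A} → P → (if ⌊ d ⌋ then x else y) ≡ x
if-yes (yes _) p = refl
if-yes (no ¬p) p = contradiction p ¬p

if-no : ∀ {A P : Set} (d : Dec P) {x y : A} → ¬ P → (if ⌊ d ⌋ then x else y) ≡ y
if-no (yes p) ¬p = contradiction p ¬p
if-no (no _)  ¬p = refl

-- Signed transpositions

module _ {n : ℕ} where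

  bar-involutive : (a : SI n) → bar (bar a) ≡ a
  bar-involutive (s , j) = cong (_, j) (BoolP.not-involutive s)

  bar-≢ : (a : SI n) → bar a ≢ a
  bar-≢ (s , j) e = BoolP.not-¬ refl (sym (cong proj₁ e))

  bar-injective : {a b : SI n} → bar a ≡ bar b → a ≡ b
  bar-injective {a} {b} e = trans (sym (bar-involutive a)) (trans (cong bar e) (bar-involutive b))

  data SwapCase (p q a r : SI n) : Set where
    at-p  : a ≡ p → r ≡ q → SwapCase p q a r
    at-q  : a ≢ p → a ≡ q → r ≡ p → SwapCase p q a r
    at-p̄  : a ≢ p → a ≢ q → a ≡ bar p → r ≡ bar q → SwapCase p q a r
    at-q̄  : a ≢ p → a ≢ q → a ≢ bar p → a ≡ bar q → r ≡ bar p → SwapCase p q a r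
    fixed : a ≢ p → a ≢ q → a ≢ bar p → a ≢ bar q → r ≡ a → SwapCase p q a r

  -- The last index is `swapFun p q a` unfolded, so that `with` can make its tests.
  swap-case : (p q a : SI n) → SwapCase p q a
    (if ⌊ a ≟SI p ⌋ then q else
     if ⌊ a ≟SI q ⌋ then p else
     if ⌊ a ≟SI bar p ⌋ then bar q else
     if ⌊ a ≟SI bar q ⌋ then bar p else a)
  swap-case p q a with a ≟SI p
  ... | yes a≡p = at-p a≡p refl
  ... | no a≢p with a ≟SI q
  ... | yes a≡q = at-q a≢p a≡q refl
  ... | no a≢q with a ≟SI bar p
  ... | yes a≡p̄ = at-p̄ a≢p a≢q a≡p̄ refl
  ... | no a≢p̄ with a ≟SI bar q
  ... | yes a≡q̄ = at-q̄ a≢p a≢q a≢p̄ a≡q̄ refl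
  ... | no a≢q̄ = fixed a≢p a≢q a≢p̄ a≢q̄ refl

  swap-at-p : (p q : SI n) → swapFun p q p ≡ q
  swap-at-p p q with swap-case p q p
  ... | at-p _ r = r
  ... | at-q p≢p _ _ = contradiction refl p≢p
  ... | at-p̄ p≢p _ _ _ = contradiction refl p≢p
  ... | at-q̄ p≢p _ _ _ _ = contradiction refl p≢p
  ... | fixed p≢p _ _ _ _ = contradiction refl p≢p

  swap-at-q : (p q : SI n) → q ≢ p → swapFun p q q ≡ p
  swap-at-q p q q≢p with swap-case p q q
  ... | at-p q≡p _ = contradiction q≡p q≢p
  ... | at-q _ _ r = r
  ... | at-p̄ _ q≢q _ _ = contradiction refl q≢q
  ... | at-q̄ _ q≢q _ _ _ = contradiction refl q≢q
  ... | fixed _ q≢q _ _ _ = contradiction refl q≢q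

  swap-at-p̄ : (p q : SI n) → swapFun p q (bar p) ≡ bar q
  swap-at-p̄ p q with swap-case p q (bar p)
  ... | at-p p̄≡p _ = contradiction p̄≡p (bar-≢ p)
  ... | at-q _ refl r = trans r (sym (bar-involutive p))
  ... | at-p̄ _ _ _ r = r
  ... | at-q̄ _ _ p̄≢p̄ _ _ = contradiction refl p̄≢p̄
  ... | fixed _ _ p̄≢p̄ _ _ = contradiction refl p̄≢p̄

  swap-at-q̄ : (p q : SI n) → q ≢ p → swapFun p q (bar q) ≡ bar p
  swap-at-q̄ p q q≢p with swap-case p q (bar q)
  ... | at-p refl r = trans r (sym (bar-involutive q))
  ... | at-q _ q̄≡q _ = contradiction q̄≡q (bar-≢ q)
  ... | at-p̄ _ _ q̄≡p̄ _ = contradiction (bar-injective q̄≡p̄) q≢p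
  ... | at-q̄ _ _ _ _ r = r
  ... | fixed _ _ _ q̄≢q̄ _ = contradiction refl q̄≢q̄

  swap-involutive : (p q : SI n) → q ≢ p → ∀ a → swapFun p q (swapFun p q a) ≡ a
  swap-involutive p q q≢p a with swap-case p q a
  ... | at-p refl r = trans (cong (swapFun p q) r) (swap-at-q p q q≢p)
  ... | at-q _ refl r = trans (cong (swapFun p q) r) (swap-at-p p q)
  ... | at-p̄ _ _ refl r = trans (cong (swapFun p q) r) (swap-at-q̄ p q q≢p)
  ... | at-q̄ _ _ _ refl r = trans (cong (swapFun p q) r) (swap-at-p̄ p q)
  ... | fixed _ _ _ _ r = trans (cong (swapFun p q) r) r

-- Divisibility of polynomial functions

module _ {n : ℕ} where

  infix 4 _≐_ _∼_ _∣ₚ_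

  record _≐_ (f g : Poly n) : Set where
    constructor mk≐
    field eval-≡ : ∀ v → eval v f ≡ eval v g

  _∼_ : Poly n → Poly n → Set
  f ∼ g = f ≐ g ⊎ f ≐ ⊝ g

  -- `f ∈⟨ g ⟩` as a record, so that Agda can infer f and g.
  record _∣ₚ_ (g f : Poly n) : Set where
    constructor divides
    field
      quotient : Poly n
      equation : ∀ v → eval v f ≡ eval v quotient ℚ.* eval v g

  ∣ₚ⇒∈⟨⟩ : {f g : Poly n} → g ∣ₚ f → f ∈⟨ g ⟩
  ∣ₚ⇒∈⟨⟩ (divides h eq) = h , eq

  ∣ₚ-resp-≐ : {f f' g : Poly n} → f ≐ f' → g ∣ₚ f → g ∣ₚ f'
  ∣ₚ-resp-≐ (mk≐ f≡f') (divides h f≡hg) = divides h λ v → trans (sym (f≡f' v)) (f≡hg v)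

  ∣ₚ-trans : {f g h : Poly n} → h ∣ₚ g → g ∣ₚ f → h ∣ₚ f
  ∣ₚ-trans {f} {g} {h} (divides d g≡dh) (divides c f≡cg) = divides (c ⊗ d) λ v → begin
    eval v f                             ≡⟨ f≡cg v ⟩
    eval v c ℚ.* eval v g                ≡⟨ cong (ℚ._*_ (eval v c)) (g≡dh v) ⟩
    eval v c ℚ.* (eval v d ℚ.* eval v h) ≡⟨ ℚP.*-assoc (eval v c) (eval v d) (eval v h) ⟨
    eval v (c ⊗ d) ℚ.* eval v h          ∎
    where open ≡-Reasoning

  ∣ₚ-zero : {f g : Poly n} → f ≐ con 0ℚ → g ∣ₚ f
  ∣ₚ-zero {g = g} (mk≐ f≡0) = divides (con 0ℚ) λ v → trans (f≡0 v) (sym (ℚP.*-zeroˡ (eval v g)))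

  ∼-sym : {f g : Poly n} → f ∼ g → g ∼ f
  ∼-sym (inj₁ (mk≐ f≡g))  = inj₁ (mk≐ λ v → sym (f≡g v))
  ∼-sym (inj₂ (mk≐ f≡-g)) = inj₂ (mk≐ λ v → trans (neg-neg _) (cong ℚ.-_ (sym (f≡-g v))))
    where
    neg-neg : ∀ x → x ≡ ℚ.- (ℚ.- x)
    neg-neg = solve 1 (λ x → x := :- (:- x)) refl

  ∼⇒∣ₚ : {f g : Poly n} → f ∼ g → g ∣ₚ f
  ∼⇒∣ₚ (inj₁ (mk≐ f≡g))  = divides (con 1ℚ) λ v → trans (f≡g v) (sym (ℚP.*-identityˡ _))
  ∼⇒∣ₚ (inj₂ (mk≐ f≡-g)) = divides (con (ℚ.- 1ℚ)) λ v → trans (f≡-g v) (minus-one _)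
    where
    minus-one : ∀ x → ℚ.- x ≡ ℚ.- 1ℚ ℚ.* x
    minus-one = solve 1 (λ x → :- x := :- con 1ℚ :* x) refl

  ∣ₚ-⊝ : {f g : Poly n} → g ∣ₚ f → g ∣ₚ ⊝ f
  ∣ₚ-⊝ {g = g} (divides h f≡hg) = divides (⊝ h) λ v →
    trans (cong ℚ.-_ (f≡hg v)) (ℚP.neg-distribˡ-* (eval v h) (eval v g))

module _ {n : ℕ} where

  xs-bar : (a : SI n) → ∀ v → eval v (xs (bar a)) ≡ ℚ.- eval v (xs a)
  xs-bar (true  , j) v = refl
  xs-bar (false , j) v = solve 1 (λ x → x := :- (:- x)) refl (v j)

  Δ : SignedPerm n → (SI n → SI n) → SI n → Poly n
  Δ w s a = xs (fun w a) ⊖ xs (fun w (s a))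

  module _ (w : SignedPerm n) (p q : SI n) where

    private
      X : (Fin n → ℚ) → SI n → ℚ
      X v a = eval v (xs (fun w a))

      X-bar : ∀ v a → X v (bar a) ≡ ℚ.- X v a
      X-bar v a = trans (cong (eval v ∘ xs) (odd w a)) (xs-bar (fun w a) v)

      Δ-at : ∀ {a b} → swapFun p q a ≡ b → ∀ v → eval v (Δ w (swapFun p q) a) ≡ X v a ℚ.- X v b
      Δ-at {a} s≡b v = cong (λ b → X v a ℚ.- X v b) s≡b

    swap-Δ : ∀ a → Δ w (swapFun p q) a ∼ xs (fun w p) ⊖ xs (fun w q) ⊎ swapFun p q a ≡ a
    swap-Δ a with swap-case p q a
    ... | at-p refl r = inj₁ (inj₁ (mk≐ (Δ-at r)))
    ... | at-q _ refl r = inj₁ (inj₂ (mk≐ λ v → trans (Δ-at r v) (flip (X v p) (X v q))))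
      where
      flip : ∀ x y → y ℚ.- x ≡ ℚ.- (x ℚ.- y)
      flip = solve 2 (λ x y → y :- x := :- (x :- y)) refl
    ... | at-p̄ _ _ refl r = inj₁ (inj₂ (mk≐ λ v →
            trans (Δ-at r v) (trans (cong₂ ℚ._-_ (X-bar v p) (X-bar v q)) (neg-sub (X v p) (X v q)))))
      where
      neg-sub : ∀ x y → ℚ.- x ℚ.- ℚ.- y ≡ ℚ.- (x ℚ.- y)
      neg-sub = solve 2 (λ x y → :- x :- :- y := :- (x :- y)) refl
    ... | at-q̄ _ _ _ refl r = inj₁ (inj₁ (mk≐ λ v →
            trans (Δ-at r v) (trans (cong₂ ℚ._-_ (X-bar v q) (X-bar v p)) (neg-flip (X v p) (X v q)))))
      where
      neg-flip : ∀ x y → ℚ.- y ℚ.- ℚ.- x ≡ x ℚ.- y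
      neg-flip = solve 2 (λ x y → :- y :- :- x := x :- y) refl
    ... | fixed _ _ _ _ r = inj₂ r

    swap-Δ-∣ : ∀ {a} → swapFun p q a ≢ a → ∀ b → Δ w (swapFun p q) a ∣ₚ Δ w (swapFun p q) b
    swap-Δ-∣ {a} s≢a b = ∣ₚ-trans Δa∣δ δ∣Δb
      where
      Δa∣δ : Δ w (swapFun p q) a ∣ₚ xs (fun w p) ⊖ xs (fun w q)
      Δa∣δ with swap-Δ a
      ... | inj₁ Δa∼δ = ∼⇒∣ₚ (∼-sym Δa∼δ)
      ... | inj₂ s≡a = contradiction s≡a s≢a
      δ∣Δb : xs (fun w p) ⊖ xs (fun w q) ∣ₚ Δ w (swapFun p q) b
      δ∣Δb with swap-Δ b
      ... | inj₁ Δb∼δ = ∼⇒∣ₚ Δb∼δ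
      ... | inj₂ s≡b = ∣ₚ-zero (mk≐ λ v → trans (Δ-at s≡b v) (ℚP.+-inverseʳ (X v b)))

reflOf-involutive : ∀ {n} (α : PosRoot n) a → reflOf α (reflOf α a) ≡ a
reflOf-involutive (minus i j i<j) =
  swap-involutive (pos i) (pos j) λ j≡i → ℕP.<-irrefl (cong (toℕ ∘ proj₂) (sym j≡i)) i<j
reflOf-involutive (plus i j _)    = swap-involutive (pos i) (neg j) λ ()
reflOf-involutive (long i)        = swap-involutive (pos i) (neg i) λ ()

reflOf-Δ-∣ : ∀ {n} (α : PosRoot n) (w : SignedPerm n) {a} → reflOf α a ≢ a →
             ∀ b → Δ w (reflOf α) a ∣ₚ Δ w (reflOf α) b
reflOf-Δ-∣ (minus i j _) w = swap-Δ-∣ w (pos i) (pos j)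
reflOf-Δ-∣ (plus i j _)  w = swap-Δ-∣ w (pos i) (neg j)
reflOf-Δ-∣ (long i)      w = swap-Δ-∣ w (pos i) (neg i)

-- Reflections preserving [i] ∪ {i + 1}

MapsInto : ∀ {n} → (SI n → SI n) → ℕ → ℕ → Set
MapsInto s i i' = ∀ j → toℕ j ≤ i → ∃ λ j' → toℕ j' ≤ i' × s (pos j) ≡ pos j'

-- With 0-based indices, these are the roots whose reflection moves some positive index ≤ i
-- to something other than a positive index ≤ i + 1.
record Confining {n : ℕ} (H : PosRoot n → Set) (i : ℕ) : Set where
  field
    minus-∉ : ∀ a b a<b → toℕ a ≤ i → suc (suc i) ≤ toℕ b → ¬ H (minus a b a<b)
    plus-∉  : ∀ a b a<b → toℕ a ≤ i → ¬ H (plus a b a<b)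
    long-∉  : ∀ a → toℕ a ≤ i → ¬ H (long a)

confined-reflection : ∀ {n} {H : PosRoot n → Set} {i : ℕ} → Confining H i →
                      ∀ α → H α → MapsInto (reflOf α) i (suc i)
confined-reflection conf (minus a b a<b) Hα j j≤i with swap-case (pos a) (pos b) (pos j)
... | at-p refl r = b , ℕP.≮⇒≥ (λ i+1<b → Confining.minus-∉ conf a b a<b j≤i i+1<b Hα) , r
... | at-q _ refl r = a , ℕP.≤-trans (ℕP.<⇒≤ a<b) (ℕP.m≤n⇒m≤1+n j≤i) , r
... | fixed _ _ _ _ r = j , ℕP.m≤n⇒m≤1+n j≤i , r
confined-reflection conf (plus a b a<b) Hα j j≤i with swap-case (pos a) (neg b) (pos j)
... | at-p refl _ = contradiction Hα (Confining.plus-∉ conf a b a<b j≤i)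
... | at-q̄ _ _ _ refl _ = contradiction Hα (Confining.plus-∉ conf a b a<b (ℕP.≤-trans (ℕP.<⇒≤ a<b) j≤i))
... | fixed _ _ _ _ r = j , ℕP.m≤n⇒m≤1+n j≤i , r
confined-reflection conf (long a) Hα j j≤i with swap-case (pos a) (neg a) (pos j)
... | at-p refl _ = contradiction Hα (Confining.long-∉ conf a j≤i)
... | at-q̄ _ _ _ refl _ = contradiction Hα (Confining.long-∉ conf a j≤i)
... | fixed _ _ _ _ r = j , ℕP.m≤n⇒m≤1+n j≤i , r

module _ {m : ℕ} (i₀ : Fin (suc m)) (k : SI (suc (suc m))) where

  Active : SignedPerm (suc (suc m)) → Set
  Active w = ∃ λ j → toℕ j ≤ toℕ i₀ × fun w (pos j) ≡ k

  active? : ∀ w → Dec (Active w)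
  active? w = FinP.any? λ j → (toℕ j ℕ.≤? toℕ i₀) ×-dec (fun w (pos j) ≟SI k)

  module _ (s : SI (suc (suc m)) → SI (suc (suc m))) (s-involutive : ∀ a → s (s a) ≡ a)
           (s-maps : MapsInto s (toℕ i₀) (suc (toℕ i₀)))
           (w ws : SignedPerm (suc (suc m))) (ws≗w∘s : fun ws ≗ fun w ∘ s) where

    private
      next : SI (suc (suc m))
      next = pos (Fin.suc i₀)

      X : (Fin (suc (suc m)) → ℚ) → SI (suc (suc m)) → ℚ
      X v a = eval v (xs a)

    ws∘s≗w : ∀ a → fun ws (s a) ≡ fun w a
    ws∘s≗w a = trans (ws≗w∘s (s a)) (cong (fun w) (s-involutive a))

    escapes-to-next : ∀ j → toℕ j ≤ toℕ i₀ → (∀ j' → toℕ j' ≤ toℕ i₀ → s (pos j) ≢ pos j') →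
                      s (pos j) ≡ next
    escapes-to-next j j≤i stays-out with s-maps j j≤i
    ... | j' , j'≤i+1 , sj≡j' with toℕ j' ℕ.≤? toℕ i₀
    ...   | yes j'≤i = contradiction sj≡j' (stays-out j' j'≤i)
    ...   | no  j'≰i = trans sj≡j' (cong pos (FinP.toℕ-injective (ℕP.≤-antisym j'≤i+1 (ℕP.≰⇒> j'≰i))))

    -- `active?` is the test in the definition of `yPoly`, so each branch fixes both values.
    yPoly-∣ : (g : Poly (suc (suc m))) → (∀ a → g ∣ₚ Δ w s a) → g ∣ₚ yPoly i₀ k w ⊖ yPoly i₀ k ws
    yPoly-∣ g g∣Δ with active? w | active? ws
    ... | yes _ | yes _ = ∣ₚ-resp-≐ (mk≐ λ v →
          trans (cong (λ b → ℚ.- (X v (fun w next) ℚ.- X v b)) (sym (ws≗w∘s next)))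
                (cancel (X v k) (X v (fun w next)) (X v (fun ws next))))
        (∣ₚ-⊝ (g∣Δ next))
      where
      cancel : ∀ x y z → ℚ.- (y ℚ.- z) ≡ (x ℚ.- y) ℚ.- (x ℚ.- z)
      cancel = solve 3 (λ x y z → :- (y :- z) := (x :- y) :- (x :- z)) refl
    ... | no _ | no _ = ∣ₚ-zero (mk≐ λ v → refl)
    ... | yes (j , j≤i , wj≡k) | no ¬aws = ∣ₚ-resp-≐ (mk≐ λ v →
          trans (cong₂ (λ a b → X v a ℚ.- X v b) wj≡k (cong (fun w) sj≡next))
                (sym (minus-zero (X v k ℚ.- X v (fun w next)))))
        (g∣Δ (pos j))
      where
      minus-zero : ∀ x → x ℚ.- 0ℚ ≡ x
      minus-zero = solve 1 (λ x → x :- con 0ℚ := x) refl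
      sj≡next : s (pos j) ≡ next
      sj≡next = escapes-to-next j j≤i λ j' j'≤i sj≡j' →
        ¬aws (j' , j'≤i , trans (cong (fun ws) (sym sj≡j')) (trans (ws∘s≗w (pos j)) wj≡k))
    ... | no ¬aw | yes (j , j≤i , wsj≡k) = ∣ₚ-resp-≐ (mk≐ λ v →
          trans (cong₂ (λ a b → X v a ℚ.- X v b) (sym ws-next) (trans (sym (ws≗w∘s (pos j))) wsj≡k))
                (sym (zero-minus (X v (fun ws next)) (X v k))))
        (g∣Δ (pos j))
      where
      zero-minus : ∀ x y → 0ℚ ℚ.- (y ℚ.- x) ≡ x ℚ.- y
      zero-minus = solve 2 (λ x y → con 0ℚ :- (y :- x) := x :- y) refl
      sj≡next : s (pos j) ≡ next
      sj≡next = escapes-to-next j j≤i λ j' j'≤i sj≡j' →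
        ¬aw (j' , j'≤i , trans (cong (fun w) (sym sj≡j')) (trans (sym (ws≗w∘s (pos j))) wsj≡k))
      ws-next : fun ws next ≡ fun w (pos j)
      ws-next = trans (cong (fun ws) (sym sj≡next)) (ws∘s≗w (pos j))

-- The dominance order of roots

∑-cong : ∀ {n} {f g : Fin n → ℤ} → (∀ j → f j ≡ g j) → ∑ f ≡ ∑ g
∑-cong {zero}  f≡g = refl
∑-cong {suc n} f≡g = cong₂ ℤ._+_ (f≡g Fin.zero) (∑-cong (f≡g ∘ Fin.suc))

∑-zero : ∀ {n} (f : Fin n → ℤ) → (∀ j → f j ≡ + 0) → ∑ f ≡ + 0
∑-zero {zero}  f f≡0 = refl
∑-zero {suc n} f f≡0 = cong₂ ℤ._+_ (f≡0 Fin.zero) (∑-zero (f ∘ Fin.suc) (f≡0 ∘ Fin.suc))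

∑-single : ∀ {n} (f : Fin n → ℤ) (r : Fin n) → (∀ j → j ≢ r → f j ≡ + 0) → ∑ f ≡ f r
∑-single {suc n} f Fin.zero f≡0 =
  trans (cong (ℤ._+_ (f Fin.zero)) (∑-zero (f ∘ Fin.suc) (λ j → f≡0 (Fin.suc j) λ ())))
        (ℤP.+-identityʳ _)
∑-single {suc n} f (Fin.suc r) f≡0 =
  trans (cong (ℤ._+ ∑ (f ∘ Fin.suc)) (f≡0 Fin.zero λ ()))
        (trans (ℤP.+-identityˡ _)
               (∑-single (f ∘ Fin.suc) r (λ j j≢r → f≡0 (Fin.suc j) (j≢r ∘ FinP.suc-injective))))

∑-+ : ∀ {n} (f g : Fin n → ℤ) → ∑ (λ j → f j ℤ.+ g j) ≡ ∑ f ℤ.+ ∑ g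
∑-+ {zero}  f g = refl
∑-+ {suc n} f g =
  trans (cong (ℤ._+_ (f Fin.zero ℤ.+ g Fin.zero)) (∑-+ (f ∘ Fin.suc) (g ∘ Fin.suc)))
        (interchange (f Fin.zero) (g Fin.zero) (∑ (f ∘ Fin.suc)) (∑ (g ∘ Fin.suc)))

module _ {n : ℕ} where

  infixl 6 _+ᵥ_
  infix 8 -ᵥ_
  infixr 7 _·ᵥ_

  _+ᵥ_ : (Fin n → ℤ) → (Fin n → ℤ) → Fin n → ℤ
  (u +ᵥ v) k = u k ℤ.+ v k

  -ᵥ_ : (Fin n → ℤ) → Fin n → ℤ
  (-ᵥ u) k = ℤ.- u k

  _·ᵥ_ : ℤ → (Fin n → ℤ) → Fin n → ℤ
  (c ·ᵥ u) k = c ℤ.* u k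

  0ᵥ : Fin n → ℤ
  0ᵥ k = + 0

  -- Zero when i ≥ n; indexed by ℕ so that `e-antitone` can walk along i.
  e : ℕ → Fin n → ℤ
  e i k = if ⌊ i ℕ.≟ toℕ k ⌋ then + 1 else + 0

  ind≡e : (a k : Fin n) → ind k a ≡ e (toℕ a) k
  ind≡e a k with k FinP.≟ a | toℕ a ℕ.≟ toℕ k
  ... | yes _   | yes _   = refl
  ... | no  _   | no  _   = refl
  ... | yes k≡a | no  a≢k = contradiction (cong toℕ (sym k≡a)) a≢k
  ... | no  k≢a | yes a≡k = contradiction (FinP.toℕ-injective (sym a≡k)) k≢a

infix 4 _≼[_]_

-- `_≤[_]_` extended to all integer vectors (see ≼⇒≤), so that chains may pass through non-roots.
record _≼[_]_ {n : ℕ} (u : Fin n → ℤ) (T : Typ) (v : Fin n → ℤ) : Set where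
  constructor mk≼
  field
    coeffs : Fin n → ℕ
    decomposition : ∀ k → v k ≡ u k ℤ.+ ∑ (λ j → + coeffs j ℤ.* simpleVec T j k)

≼⇒≤ : ∀ {n T} (α β : PosRoot n) → rootVec T α ≼[ T ] rootVec T β → α ≤[ T ] β
≼⇒≤ _ _ (mk≼ c decomp) = c , decomp

module _ {n : ℕ} {T : Typ} where

  private
    combo : (Fin n → ℕ) → Fin n → ℤ
    combo c k = ∑ (λ j → + c j ℤ.* simpleVec T j k)

  ≼-refl : {u : Fin n → ℤ} → u ≼[ T ] u
  ≼-refl {u} = mk≼ (λ _ → 0) λ k →
    sym (trans (cong (ℤ._+_ (u k)) (∑-zero _ λ j → ℤP.*-zeroˡ (simpleVec T j k))) (ℤP.+-identityʳ (u k)))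

  ≼-trans : {u v w : Fin n → ℤ} → u ≼[ T ] v → v ≼[ T ] w → u ≼[ T ] w
  ≼-trans {u} {v} {w} (mk≼ c v≡u+c) (mk≼ d w≡v+d) = mk≼ (λ j → c j ℕ.+ d j) λ k → begin
    w k                                  ≡⟨ w≡v+d k ⟩
    v k ℤ.+ combo d k                    ≡⟨ cong (ℤ._+ combo d k) (v≡u+c k) ⟩
    u k ℤ.+ combo c k ℤ.+ combo d k      ≡⟨ ℤP.+-assoc (u k) _ _ ⟩
    u k ℤ.+ (combo c k ℤ.+ combo d k)    ≡⟨ cong (ℤ._+_ (u k)) (sym (combo-+ k)) ⟩
    u k ℤ.+ combo (λ j → c j ℕ.+ d j) k  ∎
    where
    open ≡-Reasoning
    combo-+ : ∀ k → combo (λ j → c j ℕ.+ d j) k ≡ combo c k ℤ.+ combo d k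
    combo-+ k = trans (∑-cong λ j → ℤP.*-distribʳ-+ (simpleVec T j k) (+ c j) (+ d j))
                      (∑-+ (λ j → + c j ℤ.* simpleVec T j k) (λ j → + d j ℤ.* simpleVec T j k))

  ≼-resp : {u u' v v' : Fin n → ℤ} → u ≗ u' → v ≗ v' → u ≼[ T ] v → u' ≼[ T ] v'
  ≼-resp u≗u' v≗v' (mk≼ c v≡u+c) =
    mk≼ c λ k → trans (sym (v≗v' k)) (trans (v≡u+c k) (cong (ℤ._+ combo c k) (u≗u' k)))

  ≼-translate : {u v : Fin n → ℤ} (w : Fin n → ℤ) → u ≼[ T ] v → u +ᵥ w ≼[ T ] v +ᵥ w
  ≼-translate {u} {v} w (mk≼ c v≡u+c) =
    mk≼ c λ k → trans (cong (ℤ._+ w k) (v≡u+c k)) (shift (u k) (combo c k) (w k))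
    where
    shift : ∀ x y z → x ℤ.+ y ℤ.+ z ≡ x ℤ.+ z ℤ.+ y
    shift = solve-∀

  ≼-+ : {u u' v v' : Fin n → ℤ} → u ≼[ T ] u' → v ≼[ T ] v' → u +ᵥ v ≼[ T ] u' +ᵥ v'
  ≼-+ {u} {u'} {v} {v'} u≼u' v≼v' =
    ≼-trans (≼-translate v u≼u')
            (≼-resp (λ k → ℤP.+-comm (v k) (u' k)) (λ k → ℤP.+-comm (v' k) (u' k))
                    (≼-translate u' v≼v'))

  ≼-neg : {u v : Fin n → ℤ} → u ≼[ T ] v → -ᵥ v ≼[ T ] -ᵥ u
  ≼-neg {u} {v} (mk≼ c v≡u+c) =
    mk≼ c λ k → trans (neg-shift (u k) (combo c k)) (cong (λ x → ℤ.- x ℤ.+ combo c k) (sym (v≡u+c k)))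
    where
    neg-shift : ∀ x y → ℤ.- x ≡ ℤ.- (x ℤ.+ y) ℤ.+ y
    neg-shift = solve-∀

  ≼-simple : (v : Fin n → ℤ) (r : Fin n) → v ≼[ T ] v +ᵥ simpleVec T r
  ≼-simple v r = mk≼ indicator λ k → cong (ℤ._+_ (v k)) (sym (trans (∑-single _ r (off-r k)) (at-r k)))
    where
    indicator : Fin n → ℕ
    indicator j = if ⌊ j FinP.≟ r ⌋ then 1 else 0
    off-r : ∀ k j → j ≢ r → + indicator j ℤ.* simpleVec T j k ≡ + 0
    off-r k j j≢r =
      trans (cong (λ c → + c ℤ.* simpleVec T j k) (if-no (j FinP.≟ r) j≢r)) (ℤP.*-zeroˡ (simpleVec T j k))
    at-r : ∀ k → + indicator r ℤ.* simpleVec T r k ≡ simpleVec T r k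
    at-r k = trans (cong (λ c → + c ℤ.* simpleVec T r k) (if-yes (r FinP.≟ r) refl)) (ℤP.*-identityˡ _)

  simpleVec-inner : (r : Fin n) → suc (toℕ r) < n → simpleVec T r ≗ e (toℕ r) +ᵥ -ᵥ e (suc (toℕ r))
  simpleVec-inner r r+1<n k =
    trans (if-no (suc (toℕ r) ℕ.≟ n) (λ r+1≡n → ℕP.<-irrefl r+1≡n r+1<n))
          (cong (ℤ._- e (suc (toℕ r)) k) (ind≡e r k))

  simpleVec-last : (r : Fin n) → suc (toℕ r) ≡ n → simpleVec T r ≗ longCoef T ·ᵥ e (toℕ r)
  simpleVec-last r r+1≡n k =
    trans (if-yes (suc (toℕ r) ℕ.≟ n) r+1≡n) (cong (ℤ._*_ (longCoef T)) (ind≡e r k))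

  e-step : {i : ℕ} → suc i < n → e (suc i) ≼[ T ] e i
  e-step {i} i+1<n = ≼-resp (λ _ → refl) step (≼-simple (e (suc i)) r)
    where
    i<n : i < n
    i<n = ℕP.<-trans (ℕP.n<1+n i) i+1<n
    r : Fin n
    r = Fin.fromℕ< i<n
    r≡i : toℕ r ≡ i
    r≡i = FinP.toℕ-fromℕ< i<n
    cancel : ∀ x y → x ℤ.+ (y ℤ.- x) ≡ y
    cancel = solve-∀
    step : e (suc i) +ᵥ simpleVec T r ≗ e i
    step k = begin
      e (suc i) k ℤ.+ simpleVec T r k
        ≡⟨ cong (ℤ._+_ (e (suc i) k)) (simpleVec-inner r (subst (λ j → suc j < n) (sym r≡i) i+1<n) k) ⟩
      e (suc i) k ℤ.+ (e (toℕ r) k ℤ.- e (suc (toℕ r)) k)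
        ≡⟨ cong (λ j → e (suc i) k ℤ.+ (e j k ℤ.- e (suc j) k)) r≡i ⟩
      e (suc i) k ℤ.+ (e i k ℤ.- e (suc i) k)
        ≡⟨ cancel (e (suc i) k) (e i k) ⟩
      e i k ∎
      where open ≡-Reasoning

  e-antitone′ : {i i' : ℕ} → i ≤′ i' → i' < n → e i' ≼[ T ] e i
  e-antitone′ ≤′-refl          _      = ≼-refl
  e-antitone′ (≤′-step i≤′i') i'+1<n =
    ≼-trans (e-step i'+1<n) (e-antitone′ i≤′i' (ℕP.<-trans (ℕP.n<1+n _) i'+1<n))

  e-antitone : {i i' : ℕ} → i ≤ i' → i' < n → e i' ≼[ T ] e i
  e-antitone i≤i' = e-antitone′ (ℕP.≤⇒≤′ i≤i')

  -e-monotone : {i i' : ℕ} → i ≤ i' → i' < n → -ᵥ e i ≼[ T ] -ᵥ e i'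
  -e-monotone i≤i' i'<n = ≼-neg (e-antitone i≤i' i'<n)

module _ {l : ℕ} {T : Typ} where

  ≼-long : (v : Fin (suc l) → ℤ) → v ≼[ T ] v +ᵥ longCoef T ·ᵥ e l
  ≼-long v = ≼-resp (λ _ → refl) (λ k → cong (ℤ._+_ (v k)) (trans (last-root k) (at-l k)))
                    (≼-simple {T = T} v L)
    where
    L : Fin (suc l)
    L = Fin.fromℕ l
    last-root : simpleVec T L ≗ longCoef T ·ᵥ e (toℕ L)
    last-root = simpleVec-last {T = T} L (cong suc (FinP.toℕ-fromℕ l))
    at-l : longCoef T ·ᵥ e (toℕ L) ≗ longCoef T ·ᵥ e l
    at-l k = cong (λ j → (longCoef T ·ᵥ e j) k) (FinP.toℕ-fromℕ l)

-e≼e-last : ∀ {l} (T : Typ) → -ᵥ e l ≼[ T ] e {suc l} l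
-e≼e-last {l} B = ≼-trans (≼-resp (λ _ → refl) (λ k → cancel (e l k)) (≼-long (-ᵥ e l)))
                          (≼-resp (λ _ → refl) (λ k → unit (e l k)) (≼-long 0ᵥ))
  where
  cancel : ∀ x → ℤ.- x ℤ.+ + 1 ℤ.* x ≡ + 0
  cancel = solve-∀
  unit : ∀ x → + 0 ℤ.+ + 1 ℤ.* x ≡ x
  unit = solve-∀
-e≼e-last {l} C = ≼-resp (λ _ → refl) (λ k → cancel (e l k)) (≼-long (-ᵥ e l))
  where
  cancel : ∀ x → ℤ.- x ℤ.+ + 2 ℤ.* x ≡ x
  cancel = solve-∀

-e≼e : ∀ {l} {i j : ℕ} (T : Typ) → i ≤ l → j ≤ l → -ᵥ e i ≼[ T ] e {suc l} j
-e≼e T i≤l j≤l = ≼-trans (-e-monotone i≤l ℕP.≤-refl) (≼-trans (-e≼e-last T) (e-antitone j≤l ℕP.≤-refl))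

-e≼0 : ∀ {l} {i : ℕ} → i ≤ l → -ᵥ e i ≼[ B ] 0ᵥ {suc l}
-e≼0 {l} i≤l =
  ≼-trans (-e-monotone i≤l ℕP.≤-refl) (≼-resp (λ _ → refl) (λ k → cancel (e l k)) (≼-long (-ᵥ e l)))
  where
  cancel : ∀ x → ℤ.- x ℤ.+ + 1 ℤ.* x ≡ + 0
  cancel = solve-∀

longCoef-mono : ∀ {n} {u v : Fin n → ℤ} (T : Typ) →
                u ≼[ T ] v → longCoef T ·ᵥ u ≼[ T ] longCoef T ·ᵥ v
longCoef-mono {u = u} {v} B u≼v =
  ≼-resp (λ k → sym (ℤP.*-identityˡ (u k))) (λ k → sym (ℤP.*-identityˡ (v k))) u≼v
longCoef-mono {u = u} {v} C u≼v = ≼-resp (λ k → double (u k)) (λ k → double (v k)) (≼-+ u≼v u≼v)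
  where
  double : ∀ x → x ℤ.+ x ≡ + 2 ℤ.* x
  double = solve-∀

module _ {n : ℕ} (T : Typ) where

  rootVec-minus : (a b : Fin n) (a<b : a Fin.< b) → rootVec T (minus a b a<b) ≗ e (toℕ a) +ᵥ -ᵥ e (toℕ b)
  rootVec-minus a b _ k = cong₂ ℤ._-_ (ind≡e a k) (ind≡e b k)

  rootVec-plus : (a b : Fin n) (a<b : a Fin.< b) → rootVec T (plus a b a<b) ≗ e (toℕ a) +ᵥ e (toℕ b)
  rootVec-plus a b _ k = cong₂ ℤ._+_ (ind≡e a k) (ind≡e b k)

  rootVec-long : (a : Fin n) → rootVec T (long a) ≗ longCoef T ·ᵥ e (toℕ a)
  rootVec-long a k = cong (ℤ._*_ (longCoef T)) (ind≡e a k)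

e-diff-≼-long : ∀ {l a i j} (T : Typ) → a ≤ i → i ≤ l → j ≤ l →
                e i +ᵥ -ᵥ e j ≼[ T ] longCoef T ·ᵥ e {suc l} a
e-diff-≼-long {a = a} B a≤i i≤l j≤l =
  ≼-resp (λ _ → refl) (λ k → plus-zero (e a k)) (≼-+ (e-antitone a≤i (ℕ.s≤s i≤l)) (-e≼0 j≤l))
  where
  plus-zero : ∀ x → x ℤ.+ + 0 ≡ + 1 ℤ.* x
  plus-zero = solve-∀
e-diff-≼-long {a = a} C a≤i i≤l j≤l =
  ≼-resp (λ _ → refl) (λ k → double (e a k))
         (≼-+ (e-antitone a≤i (ℕ.s≤s i≤l)) (-e≼e C j≤l (ℕP.≤-trans a≤i i≤l)))
  where
  double : ∀ x → x ℤ.+ x ≡ + 2 ℤ.* x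
  double = solve-∀

-- Hessenberg spaces avoiding tᵢ

module _ {m : ℕ} (T : Typ) {H : PosRoot (suc (suc m)) → Set} (hH : IsHessenberg T H) where

  downward-closed : {α β : PosRoot (suc (suc m))} {u v : Fin (suc (suc m)) → ℤ} →
                    rootVec T β ≗ u → rootVec T α ≗ v → u ≼[ T ] v → H α → H β
  downward-closed {α} {β} β≗u α≗v u≼v = proj₂ hH β α (≼⇒≤ β α (≼-resp (sym ∘ β≗u) (sym ∘ α≗v) u≼v))

  confining-mid : (j : Fin m) → ¬ InS H (tMid j) → Confining H (toℕ j)
  confining-mid j ¬tMid = record
    { minus-∉ = λ a b a<b a≤i i+2≤b → ¬tMid ∘ witness ∘ downward-closed tMid-vec (rootVec-minus T a b a<b)
        (≼-+ (e-antitone a≤i i<n) (-e-monotone i+2≤b (FinP.toℕ<n b)))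
    ; plus-∉ = λ a b a<b a≤i → ¬tMid ∘ witness ∘ downward-closed tMid-vec (rootVec-plus T a b a<b)
        (≼-+ (e-antitone a≤i i<n) (-e≼e T i+2≤l (ℕP.≤-pred (FinP.toℕ<n b))))
    ; long-∉ = λ a a≤i → ¬tMid ∘ witness ∘ downward-closed tMid-vec (rootVec-long T a)
        (e-diff-≼-long T a≤i (ℕP.<⇒≤ i<l) i+2≤l)
    }
    where
    i : ℕ
    i = toℕ j
    i<l : i < suc m
    i<l = ℕP.m≤n⇒m≤1+n (FinP.toℕ<n j)
    i<n : i < suc (suc m)
    i<n = ℕP.m≤n⇒m≤1+n i<l
    i+2≤l : suc (suc i) ≤ suc m
    i+2≤l = ℕ.s≤s (FinP.toℕ<n j)
    j₀ : Fin (suc (suc m))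
    j₀ = Fin.inject₁ (Fin.inject₁ j)
    j₀≡i : toℕ j₀ ≡ i
    j₀≡i = trans (FinP.toℕ-inject₁ (Fin.inject₁ j)) (FinP.toℕ-inject₁ j)
    j₀<j+2 : j₀ Fin.< Fin.suc (Fin.suc j)
    j₀<j+2 = subst (_< suc (suc i)) (sym j₀≡i) (ℕP.m≤n⇒m≤1+n ℕP.≤-refl)
    root : PosRoot (suc (suc m))
    root = minus j₀ (Fin.suc (Fin.suc j)) j₀<j+2
    tMid-vec : rootVec T root ≗ e i +ᵥ -ᵥ e (suc (suc i))
    tMid-vec k = trans (rootVec-minus T j₀ (Fin.suc (Fin.suc j)) j₀<j+2 k)
                       (cong (λ x → (e x +ᵥ -ᵥ e (suc (suc i))) k) j₀≡i)
    witness : H root → InS H (tMid j)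
    witness Hroot = root , Hroot , λ _ → refl

  confining-last : ¬ InS H tPen → ¬ InS H tLast → Confining H m
  confining-last ¬tPen ¬tLast = record
    { minus-∉ = λ a b a<b a≤m m+2≤b → contradiction m+2≤b (ℕP.<⇒≱ (FinP.toℕ<n b))
    ; plus-∉ = λ a b a<b a≤m → ¬tLast ∘ tLast-witness ∘ downward-closed tLast-vec (rootVec-plus T a b a<b)
        (≼-+ (e-antitone a≤m m<n) (e-antitone (ℕP.≤-pred (FinP.toℕ<n b)) ℕP.≤-refl))
    ; long-∉ = λ a a≤m → ¬tPen ∘ tPen-witness ∘ downward-closed tPen-vec (rootVec-long T a)
        (longCoef-mono T (e-antitone a≤m m<n))
    }
    where
    m<n : m < suc (suc m)
    m<n = ℕP.m≤n⇒m≤1+n ℕP.≤-refl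
    M : Fin (suc (suc m))
    M = Fin.inject₁ (Fin.fromℕ m)
    M≡m : toℕ M ≡ m
    M≡m = trans (FinP.toℕ-inject₁ (Fin.fromℕ m)) (FinP.toℕ-fromℕ m)
    M<L : M Fin.< Fin.fromℕ (suc m)
    M<L = subst₂ _<_ (sym M≡m) (sym (FinP.toℕ-fromℕ (suc m))) ℕP.≤-refl
    tPen-root tLast-root : PosRoot (suc (suc m))
    tPen-root = long M
    tLast-root = plus M (Fin.fromℕ (suc m)) M<L
    tPen-vec : rootVec T tPen-root ≗ longCoef T ·ᵥ e m
    tPen-vec k = trans (rootVec-long T M k) (cong (λ x → (longCoef T ·ᵥ e x) k) M≡m)
    tLast-vec : rootVec T tLast-root ≗ e m +ᵥ e (suc m)
    tLast-vec k = trans (rootVec-plus T M (Fin.fromℕ (suc m)) M<L k)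
                        (cong₂ (λ x y → (e x +ᵥ e y) k) M≡m (FinP.toℕ-fromℕ (suc m)))
    tPen-witness : H tPen-root → InS H tPen
    tPen-witness Hroot = tPen-root , Hroot , λ _ → refl
    tLast-witness : H tLast-root → InS H tLast
    tLast-witness Hroot = tLast-root , Hroot , λ _ → refl

confining : ∀ {m} (T : Typ) {H : PosRoot (suc (suc m)) → Set} → IsHessenberg T H →
  (i₀ : Fin (suc m)) →
  ((∃ λ j → i₀ ≡ Fin.inject₁ j × ¬ InS H (tMid j)) ⊎ (i₀ ≡ Fin.fromℕ m × ¬ InS H tPen × ¬ InS H tLast)) →
  Confining H (toℕ i₀)
confining T {H} hH _ (inj₁ (j , refl , ¬tMid)) =
  subst (Confining H) (sym (FinP.toℕ-inject₁ j)) (confining-mid T hH j ¬tMid)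
confining {m} T {H} hH _ (inj₂ (refl , ¬tPen , ¬tLast)) =
  subst (Confining H) (sym (FinP.toℕ-fromℕ m)) (confining-last T hH ¬tPen ¬tLast)

lemma6p2 : (m : ℕ) (T : Typ) (H : PosRoot (suc (suc m)) → Set) →
    IsHessenberg T H →
    (i₀ : Fin (suc m)) →
    ((∃ λ j → i₀ ≡ Fin.inject₁ j × ¬ InS H (tMid j))
      ⊎ (i₀ ≡ Fin.fromℕ m × ¬ InS H tPen × ¬ InS H tLast)) →
    (k : SI (suc (suc m))) → InM H (yPoly i₀ k)
lemma6p2 m T H hH i₀ hyp k α Hα p q q≢p sp≡q _ w ws ws≗w∘s =
  ∣ₚ⇒∈⟨⟩ (yPoly-∣ i₀ k (reflOf α) (reflOf-involutive α) s-maps w ws ws≗w∘s _ g∣Δ)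
  where
  s-maps : MapsInto (reflOf α) (toℕ i₀) (suc (toℕ i₀))
  s-maps = confined-reflection (confining T hH i₀ hyp) α Hα
  g∣Δ : ∀ a → xs (fun w p) ⊖ xs (fun w q) ∣ₚ Δ w (reflOf α) a
  g∣Δ = subst (λ r → ∀ a → xs (fun w p) ⊖ xs (fun w r) ∣ₚ Δ w (reflOf α) a) sp≡q
              (reflOf-Δ-∣ α w λ sp≡p → q≢p (trans (sym sp≡q) sp≡p))
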